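{- Let $L$ be a complete lattice, $F\colon L\to L$ an $\omega$-continuous function, and $\alpha\in L$. There exists a $\mathrm{KT}^\omega$ witness for $(L,F,\alpha)$ if and only if there exists a conclusive KT sequence for $(L,F,\alpha)$.
   Context: $\omega$-continuous means preserving suprema of increasing $\omega$-chains. A $\mathrm{KT}^\omega$ witness is an increasing $\omega$-chain $X=(X_0\le X_1\le\cdots)$ in $L$ with $FX_i\le X_{i+1}$ and $X_i\le\alpha$ for all $i\ge0$. A KT sequence is a finite chain $X=(X_0\le\cdots\le X_{n-1})$ in $L$ with $n\ge 2$, $X_{n-2}\le\alpha$ and $FX_i\le X_{i+1}$ for all $0\le i\le n-2$; it is conclusive if $X_{j+1}\le X_j$ for some $0\le j\le n-2$. -}

module Defs where

open import Level using (Level; _⊔_; suc)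
open import Data.Nat using (ℕ)
import Data.Nat as ℕ
open import Data.Fin using (Fin; inject₁; fromℕ)
import Data.Fin as Fin
open import Data.Product using (Σ; ∃; _×_; _,_)
open import Relation.Unary using (Pred)
open import Relation.Binary.Bundles using (Poset)

module _ {c ℓ₁ ℓ₂} (P : Poset c ℓ₁ ℓ₂) where
  open Poset P

  IsSup : ∀ {p} → Pred Carrier p → Carrier → Set (c ⊔ ℓ₂ ⊔ p)
  IsSup S s = (∀ x → S x → x ≤ s) × (∀ u → (∀ x → S x → x ≤ u) → s ≤ u)

  Range : (ℕ → Carrier) → Pred Carrier ℓ₁
  Range X x = ∃ λ i → x ≈ X i

  IncreasingChain : (ℕ → Carrier) → Set ℓ₂
  IncreasingChain X = ∀ i → X i ≤ X (ℕ.suc i)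

record CompleteLattice (c ℓ₁ ℓ₂ : Level) : Set (suc (c ⊔ ℓ₁ ⊔ ℓ₂)) where
  field
    poset : Poset c ℓ₁ ℓ₂
  open Poset poset public
  field
    ⋁     : Pred Carrier (c ⊔ ℓ₁ ⊔ ℓ₂) → Carrier
    ⋁-sup : ∀ S → IsSup poset S (⋁ S)

module _ {c ℓ₁ ℓ₂} (L : CompleteLattice c ℓ₁ ℓ₂) where
  open CompleteLattice L

  OmegaContinuous : (Carrier → Carrier) → Set (c ⊔ ℓ₁ ⊔ ℓ₂)
  OmegaContinuous F = ∀ (X : ℕ → Carrier) → IncreasingChain poset X →
    ∀ s → IsSup poset (Range poset X) s →
    IsSup poset (Range poset (λ i → F (X i))) (F s)

  KTωWitness : (Carrier → Carrier) → Carrier → (ℕ → Carrier) → Set ℓ₂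
  KTωWitness F α X = IncreasingChain poset X
                   × (∀ i → F (X i) ≤ X (ℕ.suc i))
                   × (∀ i → X i ≤ α)

  -- KT sequence of length n = m + 2 (so n ≥ 2), X : Fin n → Carrier.
  -- Indices 0 ≤ i ≤ n-2 are  i : Fin (suc m); X_i = X (inject₁ i), X_{i+1} = X (suc i).
  KTSequence : (Carrier → Carrier) → Carrier → (m : ℕ) → (Fin (ℕ.suc (ℕ.suc m)) → Carrier) → Set ℓ₂
  KTSequence F α m X = (∀ (i : Fin (ℕ.suc m)) → X (inject₁ i) ≤ X (Fin.suc i))
                     × X (inject₁ (fromℕ m)) ≤ α
                     × (∀ (i : Fin (ℕ.suc m)) → F (X (inject₁ i)) ≤ X (Fin.suc i))

  Conclusive : (m : ℕ) → (Fin (ℕ.suc (ℕ.suc m)) → Carrier) → Set ℓ₂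
  Conclusive m X = ∃ λ (j : Fin (ℕ.suc m)) → X (Fin.suc j) ≤ X (inject₁ j)

{-# OPTIONS --safe #-}
-- Both kinds of witness amount to a point x ≤ α with F x ≤ x.  The supremum of a
-- KT^ω witness is such a point by ω-continuity, and the constant sequence (x, x) is
-- then a conclusive KT sequence.  Conversely, if X_{j+1} ≤ X_j in a KT sequence then
-- F X_j ≤ X_{j+1} ≤ X_j ≤ X_{n-2} ≤ α, and the constant ω-chain at X_j is a witness.
module Submission where

open import Defs
open import Data.Nat using (ℕ; suc)
open import Data.Fin using (Fin; zero; inject₁; fromℕ)
import Data.Fin as Fin
open import Data.Product using (∃; _×_; _,_; proj₁; proj₂)
open import Function.Base using (_∘_)
open import Function.Bundles using (_⇔_; mk⇔)
open import Level using (Lift; lift; lower; _⊔_)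
open import Relation.Unary using (Pred)

module _ {c ℓ₁ ℓ₂} (L : CompleteLattice c ℓ₁ ℓ₂) where
  open CompleteLattice L

  PrefixedPointBelow : (Carrier → Carrier) → Carrier → Carrier → Set ℓ₂
  PrefixedPointBelow F α x = F x ≤ x × x ≤ α

  -- ⋁ only accepts predicates at level c ⊔ ℓ₁ ⊔ ℓ₂, hence the lift.
  ⋁-exists : (S : Pred Carrier ℓ₁) → ∃ (IsSup poset S)
  ⋁-exists S = ⋁ S↑ , (λ x s → proj₁ (⋁-sup S↑) x (lift s))
                    , (λ u ub → proj₂ (⋁-sup S↑) u (λ x s → ub x (lower s)))
    where
    S↑ : Pred Carrier (c ⊔ ℓ₁ ⊔ ℓ₂)
    S↑ x = Lift (c ⊔ ℓ₂) (S x)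

  sup-range-≤ : ∀ {X s u} → IsSup poset (Range poset X) s → (∀ i → X i ≤ u) → s ≤ u
  sup-range-≤ (_ , least) X≤u = least _ λ { _ (i , x≈Xi) → trans (reflexive x≈Xi) (X≤u i) }

  sup-prefixed : ∀ {F X s} → OmegaContinuous L F → IncreasingChain poset X →
    (∀ i → F (X i) ≤ X (suc i)) → IsSup poset (Range poset X) s → F s ≤ s
  sup-prefixed {X = X} {s} cont inc FX≤X sup@(upper , _) =
    sup-range-≤ (cont X inc s sup) λ i → trans (FX≤X i) (upper (X (suc i)) (suc i , Eq.refl))

  increasing⇒≤last : ∀ n (Y : Fin (suc n) → Carrier) →
    (∀ (i : Fin n) → Y (inject₁ i) ≤ Y (Fin.suc i)) → ∀ k → Y k ≤ Y (fromℕ n)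
  increasing⇒≤last ℕ.zero  Y inc zero        = refl
  increasing⇒≤last (suc n) Y inc zero        = trans (inc zero) (increasing⇒≤last n (Y ∘ Fin.suc) (inc ∘ Fin.suc) zero)
  increasing⇒≤last (suc n) Y inc (Fin.suc k) = increasing⇒≤last n (Y ∘ Fin.suc) (inc ∘ Fin.suc) k

  module _ (F : Carrier → Carrier) (α : Carrier) where

    KTω⇒prefixed : OmegaContinuous L F → ∀ {X} → KTωWitness L F α X → ∃ (PrefixedPointBelow F α)
    KTω⇒prefixed cont {X} (inc , FX≤X , X≤α) =
      let s , sup = ⋁-exists (Range poset X)
      in s , sup-prefixed cont inc FX≤X sup , sup-range-≤ sup X≤α

    prefixed⇒KTω : ∀ {x} → PrefixedPointBelow F α x → KTωWitness L F α (λ _ → x)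
    prefixed⇒KTω (Fx≤x , x≤α) = (λ _ → refl) , (λ _ → Fx≤x) , (λ _ → x≤α)

    prefixed⇒conclusive : ∀ {x} → PrefixedPointBelow F α x →
      KTSequence L F α 0 (λ _ → x) × Conclusive L 0 (λ _ → x)
    prefixed⇒conclusive (Fx≤x , x≤α) = ((λ _ → refl) , x≤α , (λ _ → Fx≤x)) , (zero , refl)

    conclusive⇒prefixed : ∀ m X → KTSequence L F α m X → Conclusive L m X →
      ∃ (PrefixedPointBelow F α)
    conclusive⇒prefixed m X (inc , X≤α , FX≤X) (j , back) =
      X (inject₁ j) , trans (FX≤X j) back
                    , trans (increasing⇒≤last m (X ∘ inject₁) (inc ∘ inject₁) j) X≤α

proposition1 : ∀ {c ℓ₁ ℓ₂} (L : CompleteLattice c ℓ₁ ℓ₂)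
                 (F : CompleteLattice.Carrier L → CompleteLattice.Carrier L)
                 (α : CompleteLattice.Carrier L) →
                 OmegaContinuous L F →
                 (∃ λ (X : ℕ → CompleteLattice.Carrier L) → KTωWitness L F α X)
                 ⇔ (∃ λ (m : ℕ) → ∃ λ (X : Fin (suc (suc m)) → CompleteLattice.Carrier L) →
                      KTSequence L F α m X × Conclusive L m X)
proposition1 L F α cont = mk⇔
  (λ (_ , witness) → let x , pre = KTω⇒prefixed L F α cont witness
                     in 0 , (λ _ → x) , prefixed⇒conclusive L F α pre)
  (λ (m , X , seq , concl) → let x , pre = conclusive⇒prefixed L F α m X seq concl
                            in (λ _ → x) , prefixed⇒KTω L F α pre)
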